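{- Let $K$ be a non-negative integer. Suppose $\mathcal{C}_1$ and $\mathcal{C}_2$ are classes of (finite, simple) graphs such that $\mathcal{C}_1$ is non-empty and closed under vertex deletion, and every graph $G\in\mathcal{C}_2$ satisfies $\chi(G^2)\le K+1$. Suppose furthermore that there exists an integer $K'\le K$ such that every graph $G\in\mathcal{C}_1$ satisfies at least one of the following: (i) $G\in\mathcal{C}_2$; (ii) there is a vertex $v\in V(G)$ with $\deg_{G^2}(v)\le K'$, there is a vertex $x^*\in N_G(v)$ with $\deg_{G^2}(x^*)\le K'+1$, and the set of all vertices $x\in N_G(v)$ with $\deg_{G^2}(x)>K'+2$ induces a clique in $(G\setminus v)^2$; or (iii) there is a vertex $v\in V(G)$ with $\deg_{G^2}(v)\le K'$ such that the set of all vertices $x\in N_G(v)$ with $\deg_{G^2}(x)>K'+1$ induces a clique in $(G\setminus v)^2$. Then every $G\in\mathcal{C}_1$ satisfies $\chi(G^2)\le K+1$.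
   Context: The square $H^2$ of a graph $H$ is the graph on $V(H)$ in which two distinct vertices are adjacent iff they are at distance at most $2$ in $H$. $\deg_{G^2}(v)$ is the degree of $v$ in $G^2$; $N_G(v)$ is the open neighbourhood of $v$ in $G$; $G\setminus v$ is the graph obtained from $G$ by deleting $v$. $\chi$ denotes the chromatic number. -}

module Defs where

open import Data.Nat using (ℕ; zero; suc)
open import Data.Bool using (Bool; true; false; _∧_; _∨_; not)
open import Data.Fin using (Fin; punchIn; _≟_)
open import Data.List using (List; length; filterᵇ; allFin)
open import Data.Bool.ListAction using (any)
open import Data.Integer using (ℤ; +_; _≤_; _>_; _+_)
open import Data.Product using (Σ; _×_; ∃; ∃-syntax)
open import Data.Empty using (⊥)
open import Relation.Nullary using (¬_)
open import Relation.Nullary.Decidable using (⌊_⌋)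
open import Relation.Binary.PropositionalEquality using (_≡_)

record Graph (n : ℕ) : Set where
  field
    adj    : Fin n → Fin n → Bool
    sym    : ∀ i j → adj i j ≡ adj j i
    irrefl : ∀ i → adj i i ≡ false
open Graph public

GraphClass : Set₁
GraphClass = (n : ℕ) → Graph n → Set

sqAdj : ∀ {n} → Graph n → Fin n → Fin n → Bool
sqAdj {n} G i j =
  not ⌊ i ≟ j ⌋ ∧ (adj G i j ∨ any (λ k → adj G i k ∧ adj G k j) (allFin n))

deg² : ∀ {n} → Graph n → Fin n → ℕ
deg² {n} G v = length (filterᵇ (sqAdj G v) (allFin n))

delete : ∀ {n} → Graph (suc n) → Fin (suc n) → Graph n
delete G v = record
  { adj    = λ i j → adj G (punchIn v i) (punchIn v j)
  ; sym    = λ i j → sym G (punchIn v i) (punchIn v j)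
  ; irrefl = λ i → irrefl G (punchIn v i)
  }

χ²≤ : ∀ {n} → Graph n → ℕ → Set
χ²≤ {n} G k = Σ (Fin n → Fin k) λ c → ∀ i j → sqAdj G i j ≡ true → ¬ (c i ≡ c j)

NonEmpty : GraphClass → Set
NonEmpty C = ∃[ n ] Σ (Graph n) (C n)

ClosedUnderDeletion : GraphClass → Set
ClosedUnderDeletion C = ∀ n (G : Graph (suc n)) (v : Fin (suc n)) → C (suc n) G → C n (delete G v)

-- The set { x ∈ N_G(v) : deg_{G²}(x) > t } induces a clique in (G ∖ v)².
-- Its elements other than v are written punchIn v i for vertices i of G ∖ v.
HighNbrsClique : ∀ {n} → Graph (suc n) → Fin (suc n) → ℤ → Set
HighNbrsClique {n} G v t =
  ∀ (i j : Fin n) → ¬ (i ≡ j) →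
    adj G v (punchIn v i) ≡ true → + deg² G (punchIn v i) > t →
    adj G v (punchIn v j) ≡ true → + deg² G (punchIn v j) > t →
    sqAdj (delete G v) i j ≡ true

Cond-ii : ∀ {n} → ℤ → Graph n → Set
Cond-ii {zero}  K' G = ⊥
Cond-ii {suc n} K' G =
  Σ (Fin (suc n)) λ v →
    (+ deg² G v ≤ K') ×
    (Σ (Fin (suc n)) λ x* → (adj G v x* ≡ true) × (+ deg² G x* ≤ K' + + 1)) ×
    HighNbrsClique G v (K' + + 2)

Cond-iii : ∀ {n} → ℤ → Graph n → Set
Cond-iii {zero}  K' G = ⊥
Cond-iii {suc n} K' G =
  Σ (Fin (suc n)) λ v →
    (+ deg² G v ≤ K') × HighNbrsClique G v (K' + + 1)

module Submission where

-- For v as in (ii) or (iii), colour (G ∖ v)² by induction and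
-- keep the colours of all vertices except v and its neighbours of G²-degree at most a threshold
-- (K'+1 in case (iii), K'+2 in case (ii)). This stays proper in G²: two kept vertices joined only
-- through v are high neighbours of v, hence adjacent in (G ∖ v)² by the clique condition. The
-- uncoloured neighbours are recoloured greedily; each sees at most K coloured G²-neighbours because
-- v (and in case (ii) also x*) is still uncoloured. Then x* and finally v are coloured the same way.

open import Defs hiding (sym)
open import Data.Bool using (Bool; true; false; T; T?; not; _∧_; _∨_)
open import Data.Bool.Properties using (T-≡; T-∧; T-∨)
open import Data.Bool.ListAction using (any)
open import Data.Empty using (⊥-elim)
open import Data.Fin using (Fin; zero; punchIn; punchOut; _≟_)
open import Data.Fin.Properties using (pigeonhole; <⇒≢; ¬∀⟶∃¬; punchIn-punchOut)
open import Data.Integer using (ℤ; +_; _+_; _≤_; _>_; _≤?_; +≤+)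
import Data.Integer.Properties as ℤ
open import Data.List using (List; []; _∷_; length; map; filterᵇ; allFin; lookup)
open import Data.List.Membership.Propositional using (_∈_; _∉_; lose)
open import Data.List.Membership.Propositional.Properties using (∈-allFin; ∈-filter⁺; ∈-map⁺)
open import Data.List.Properties using (length-map)
open import Data.List.Relation.Unary.All as All using (All; []; _∷_)
open import Data.List.Relation.Unary.All.Properties using (All¬⇒¬Any)
open import Data.List.Relation.Unary.Any as Any using (here; there; index)
open import Data.List.Relation.Unary.Any.Properties using (lookup-index; any⁺; any⁻)
open import Data.List.Relation.Unary.Unique.Propositional using (Unique; []; _∷_)
open import Data.Nat as ℕ using (ℕ; zero; suc; z≤n; s≤s)
open import Data.Nat.Properties as ℕ using (m≤n⇒m≤1+n)
open import Data.Product using (_×_; _,_; proj₁; proj₂; ∃; ∃-syntax)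
open import Data.Sum as Sum using (_⊎_; inj₁; inj₂)
open import Data.Vec.Functional using (updateAt; insertAt)
open import Data.Vec.Functional.Properties using (updateAt-updates; updateAt-minimal; insertAt-punchIn)
open import Function using (_∘_; id; const; case_of_; Equivalence)
open import Relation.Binary.PropositionalEquality
  using (_≡_; _≢_; refl; sym; trans; cong; subst; module ≡-Reasoning)
open import Relation.Nullary using (¬_; Dec; yes; no; ¬?; _×-dec_)
open import Relation.Nullary.Decidable using (⌊_⌋; toWitness; toWitnessFalse; fromWitness; fromWitnessFalse)
open import Relation.Unary using (_⊆_)

open Equivalence using (to; from)

length<⇒∃∉ : ∀ {m} (xs : List (Fin m)) → length xs ℕ.< m → ∃[ a ] a ∉ xs
length<⇒∃∉ {m} xs len<m = ¬∀⟶∃¬ m (_∈ xs) (λ a → Any.any? (a ≟_) xs) notAll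
  where
  notAll : ¬ (∀ a → a ∈ xs)
  notAll all∈ with pigeonhole len<m (index ∘ all∈)
  ... | i , j , i<j , sameIndex = <⇒≢ i<j (begin
    i                          ≡⟨ lookup-index (all∈ i) ⟩
    lookup xs (index (all∈ i)) ≡⟨ cong (lookup xs) sameIndex ⟩
    lookup xs (index (all∈ j)) ≡⟨ sym (lookup-index (all∈ j)) ⟩
    j                          ∎)
    where open ≡-Reasoning

module _ {a} {A : Set a} {p q : A → Bool} (p⊆q : T ∘ p ⊆ T ∘ q) where

  length-filterᵇ-mono : ∀ xs → length (filterᵇ p xs) ℕ.≤ length (filterᵇ q xs)
  length-filterᵇ-mono []       = z≤n
  length-filterᵇ-mono (x ∷ xs) with p x | q x | p⊆q {x}
  ... | true  | true  | _   = s≤s (length-filterᵇ-mono xs)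
  ... | true  | false | p⇒q = ⊥-elim (p⇒q _)
  ... | false | true  | _   = m≤n⇒m≤1+n (length-filterᵇ-mono xs)
  ... | false | false | _   = length-filterᵇ-mono xs

  length-filterᵇ-< : ∀ {x xs} → x ∈ xs → T (q x) → ¬ T (p x) →
                     length (filterᵇ p xs) ℕ.< length (filterᵇ q xs)
  length-filterᵇ-< {xs = x ∷ xs} (here refl) qx ¬px with p x | q x
  ... | true  | _     = ⊥-elim (¬px _)
  ... | false | true  = s≤s (length-filterᵇ-mono xs)
  length-filterᵇ-< {xs = y ∷ xs} (there x∈xs) qx ¬px with p y | q y | p⊆q {y}
  ... | true  | true  | _   = s≤s (length-filterᵇ-< x∈xs qx ¬px)
  ... | true  | false | p⇒q = ⊥-elim (p⇒q _)
  ... | false | true  | _   = m≤n⇒m≤1+n (length-filterᵇ-< x∈xs qx ¬px)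
  ... | false | false | _   = length-filterᵇ-< x∈xs qx ¬px

-- Chosen so that deg² G u is definitionally count (sqAdj G u).
count : ∀ {m} → (Fin m → Bool) → ℕ
count p = length (filterᵇ p (allFin _))

module _ {m} {p q : Fin m → Bool} (p⊆q : T ∘ p ⊆ T ∘ q) where

  count-mono : count p ℕ.≤ count q
  count-mono = length-filterᵇ-mono p⊆q (allFin m)

  count-< : ∀ a → T (q a) → ¬ T (p a) → count p ℕ.< count q
  count-< a = length-filterᵇ-< p⊆q (∈-allFin a)

avoiding : ∀ {N} → List (Fin N) → Fin N → Bool
avoiding xs w = ⌊ ¬? (Any.any? (w ≟_) xs) ⌋

module _ {N : ℕ} (G : Graph N) where

  adj-sym : ∀ {i j} → T (adj G i j) → T (adj G j i)
  adj-sym {i} {j} = subst T (Graph.sym G i j)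

  adj⇒≢ : ∀ {i j} → T (adj G i j) → i ≢ j
  adj⇒≢ {i} ii refl = subst T (Graph.irrefl G i) ii

  Dist≤2 : Fin N → Fin N → Set
  Dist≤2 i j = T (adj G i j) ⊎ ∃[ k ] T (adj G i k) × T (adj G k j)

  sqAdj⁺ : ∀ {i j} → i ≢ j → Dist≤2 i j → T (sqAdj G i j)
  sqAdj⁺ {i} {j} i≢j d = from T-∧ (fromWitnessFalse i≢j , from (T-∨ {adj G i j}) (Sum.map₂ viaSome d))
    where
    viaSome : ∃[ k ] T (adj G i k) × T (adj G k j) → T (any (λ k → adj G i k ∧ adj G k j) (allFin N))
    viaSome (k , ik , kj) = any⁺ _ (lose (∈-allFin k) (from T-∧ (ik , kj)))

  sqAdj⁻ : ∀ {i j} → T (sqAdj G i j) → i ≢ j × Dist≤2 i j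
  sqAdj⁻ ij with to T-∧ ij
  ... | i≢j , near with to T-∨ near
  ... | inj₁ adjacent = toWitnessFalse i≢j , inj₁ adjacent
  ... | inj₂ viaSome with Any.satisfied (any⁻ _ (allFin N) viaSome)
  ... | k , ikj = toWitnessFalse i≢j , inj₂ (k , to T-∧ ikj)

  sqAdj-sym : ∀ {i j} → T (sqAdj G i j) → T (sqAdj G j i)
  sqAdj-sym ij with sqAdj⁻ ij
  ... | i≢j , inj₁ adjacent = sqAdj⁺ (i≢j ∘ sym) (inj₁ (adj-sym adjacent))
  ... | i≢j , inj₂ (k , ik , kj) = sqAdj⁺ (i≢j ∘ sym) (inj₂ (k , adj-sym kj , adj-sym ik))

  ProperOn : ∀ {k} → (Fin N → Fin k) → (Fin N → Bool) → Set
  ProperOn c D = ∀ {i j} → T (D i) → T (D j) → T (sqAdj G i j) → c i ≢ c j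

  deg²In : Fin N → (Fin N → Bool) → ℕ
  deg²In u E = count (λ w → sqAdj G u w ∧ E w)

  freeColour : ∀ {K} (c : Fin N → Fin (suc K)) u E → deg²In u E ℕ.≤ K →
               ∃[ a ] (∀ {w} → T (sqAdj G u w) → T (E w) → c w ≢ a)
  freeColour {K} c u E bound with length<⇒∃∉ (map c nbrs) (s≤s (subst (ℕ._≤ K) (sym (length-map c nbrs)) bound))
    where nbrs = filterᵇ (λ w → sqAdj G u w ∧ E w) (allFin N)
  ... | a , a∉ = a , λ {w} uw Ew cw≡a →
    a∉ (subst (_∈ _) cw≡a (∈-map⁺ c (∈-filter⁺ (T? ∘ _) (∈-allFin w) (from T-∧ (uw , Ew)))))

  ColourableOn : ℕ → (Fin N → Bool) → Set
  ColourableOn k D = ∃ λ (c : Fin N → Fin k) → ProperOn c D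

  insert : Fin N → (Fin N → Bool) → Fin N → Bool
  insert u D w = ⌊ w ≟ u ⌋ ∨ D w

  extendColourable : ∀ {K D E u} → T ∘ D ⊆ T ∘ E → deg²In u E ℕ.≤ K →
                     ColourableOn (suc K) D → ColourableOn (suc K) (insert u D)
  extendColourable {D = D} {E} {u} D⊆E bound (c , proper) with freeColour c u E bound
  ... | a , avoids = c′ , proper′
    where
    c′ = updateAt c u (const a)

    c′-u : c′ u ≡ a
    c′-u = updateAt-updates u c

    c′-other : ∀ {w} → w ≢ u → c′ w ≡ c w
    c′-other {w} w≢u = updateAt-minimal w u c w≢u

    proper′ : ProperOn c′ (insert u D)
    proper′ {i} {j} Di Dj ij with i ≟ u | j ≟ u
    ... | yes refl | yes refl = ⊥-elim (proj₁ (sqAdj⁻ ij) refl)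
    ... | yes refl | no j≢u   = λ same →
      avoids ij (D⊆E Dj) (trans (sym (c′-other j≢u)) (trans (sym same) c′-u))
    ... | no i≢u   | yes refl = λ same →
      avoids (sqAdj-sym ij) (D⊆E Di) (trans (sym (c′-other i≢u)) (trans same c′-u))
    ... | no i≢u   | no j≢u   = λ same →
      proper Di Dj ij (trans (sym (c′-other i≢u)) (trans same (c′-other j≢u)))

  colourGreedily : ∀ {K} (L : List (Fin N)) {D E : Fin N → Bool} → T ∘ D ⊆ T ∘ E →
                   (∀ {w} → T (E w) → ¬ T (D w) → w ∈ L) →
                   (∀ {u} → T (E u) → ¬ T (D u) → deg²In u E ℕ.≤ K) →
                   ColourableOn (suc K) D → ColourableOn (suc K) E
  colourGreedily [] {D} {E} D⊆E pending bound (c , proper) = c , λ Ei Ej → proper (done Ei) (done Ej)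
    where
    done : ∀ {w} → T (E w) → T (D w)
    done {w} Ew with D w | pending {w} Ew
    ... | true  | _       = _
    ... | false | nowhere = case nowhere id of λ ()
  colourGreedily (u ∷ L) {D} {E} D⊆E pending bound with T? (E u) | T? (D u)
  ... | no ¬Eu | _ = colourGreedily L D⊆E (λ Ew ¬Dw → Any.tail (λ { refl → ¬Eu Ew }) (pending Ew ¬Dw)) bound
  ... | yes _ | yes Du = colourGreedily L D⊆E (λ Ew ¬Dw → Any.tail (λ { refl → ¬Dw Du }) (pending Ew ¬Dw)) bound
  ... | yes Eu | no ¬Du =
    colourGreedily L D′⊆E pending′ (λ Ew ¬D′w → bound Ew (¬D′w ∘ D⊆D′)) ∘ extendColourable D⊆E (bound Eu ¬Du)
    where
    D⊆D′ : T ∘ D ⊆ T ∘ insert u D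
    D⊆D′ {w} Dw = from (T-∨ {⌊ w ≟ u ⌋}) (inj₂ Dw)

    D′⊆E : T ∘ insert u D ⊆ T ∘ E
    D′⊆E {w} D′w with w ≟ u
    ... | yes refl = Eu
    ... | no _     = D⊆E D′w

    pending′ : ∀ {w} → T (E w) → ¬ T (insert u D w) → w ∈ L
    pending′ Ew ¬D′w = Any.tail (λ { refl → ¬D′w (from (T-∨ {⌊ u ≟ u ⌋}) (inj₁ (fromWitness refl))) })
                                (pending Ew (¬D′w ∘ D⊆D′))

  extendColourableTo : ∀ {K} {D E : Fin N → Bool} → T ∘ D ⊆ T ∘ E →
                       (∀ {u} → T (E u) → ¬ T (D u) → deg²In u E ℕ.≤ K) →
                       ColourableOn (suc K) D → ColourableOn (suc K) E
  extendColourableTo D⊆E = colourGreedily (allFin N) D⊆E (λ {w} _ _ → ∈-allFin w)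

  deg²In-≤-deg² : ∀ u E → deg²In u E ℕ.≤ deg² G u
  deg²In-≤-deg² u E = count-mono (λ {w} → proj₁ ∘ to (T-∧ {sqAdj G u w}))

  deg²In-< : ∀ {u a} {E E′ : Fin N → Bool} → T ∘ E ⊆ T ∘ E′ →
             T (sqAdj G u a) → T (E′ a) → ¬ T (E a) → deg²In u E ℕ.< deg²In u E′
  deg²In-< {u} {a} {E} {E′} E⊆E′ ua E′a ¬Ea =
    count-< {p = λ w → sqAdj G u w ∧ E w} {q = λ w → sqAdj G u w ∧ E′ w} sub a
            (from T-∧ (ua , E′a)) (¬Ea ∘ proj₂ ∘ to (T-∧ {sqAdj G u a}))
    where
    sub : ∀ {w} → T (sqAdj G u w ∧ E w) → T (sqAdj G u w ∧ E′ w)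
    sub {w} uwE with to (T-∧ {sqAdj G u w}) uwE
    ... | uw , Ew = from T-∧ (uw , E⊆E′ Ew)

  deg²In-avoiding-≤ : ∀ {K u} xs → Unique xs → All (T ∘ sqAdj G u) xs →
                      deg² G u ℕ.≤ length xs ℕ.+ K → deg²In u (avoiding xs) ℕ.≤ K
  deg²In-avoiding-≤ {K} {u} xs uniq adjs deg≤ =
    ℕ.+-cancelˡ-≤ (length xs) _ _ (ℕ.≤-trans (+deg²In-avoiding xs uniq adjs) deg≤)
    where
    +deg²In-avoiding : ∀ xs → Unique xs → All (T ∘ sqAdj G u) xs →
                       length xs ℕ.+ deg²In u (avoiding xs) ℕ.≤ deg² G u
    +deg²In-avoiding []       _              _          = deg²In-≤-deg² u (avoiding [])
    +deg²In-avoiding (x ∷ xs) (x∉xs ∷ uniq) (ux ∷ adjs) = begin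
      suc (length xs ℕ.+ deg²In u (avoiding (x ∷ xs))) ≡⟨ sym (ℕ.+-suc (length xs) _) ⟩
      length xs ℕ.+ suc (deg²In u (avoiding (x ∷ xs))) ≤⟨ ℕ.+-monoʳ-≤ (length xs) fewer ⟩
      length xs ℕ.+ deg²In u (avoiding xs)             ≤⟨ +deg²In-avoiding xs uniq adjs ⟩
      deg² G u                                          ∎
      where
      open ℕ.≤-Reasoning
      fewer : deg²In u (avoiding (x ∷ xs)) ℕ.< deg²In u (avoiding xs)
      fewer = deg²In-< (λ w∉ → fromWitness (toWitness w∉ ∘ there)) ux
                       (fromWitness (All¬⇒¬Any x∉xs)) (λ x∉ → toWitness x∉ (here refl))

  extendToVertex : ∀ {K} x xs → Unique xs → All (T ∘ sqAdj G x) xs → deg² G x ℕ.≤ length xs ℕ.+ K →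
                   ColourableOn (suc K) (avoiding (x ∷ xs)) → ColourableOn (suc K) (avoiding xs)
  extendToVertex x xs uniq adjs deg≤ = extendColourableTo (λ w∉ → fromWitness (toWitness w∉ ∘ there)) onlyX
    where
    onlyX : ∀ {u} → T (avoiding xs u) → ¬ T (avoiding (x ∷ xs) u) → deg²In u (avoiding xs) ℕ.≤ _
    onlyX {u} u∉xs u∈ with u ≟ x
    ... | yes refl = deg²In-avoiding-≤ xs uniq adjs deg≤
    ... | no u≢x   = ⊥-elim (u∈ (fromWitness λ { (here u≡x) → u≢x u≡x ; (there u∈xs) → toWitness u∉xs u∈xs }))

  colourable⇒χ²≤ : ∀ {k} → ColourableOn k (avoiding []) → χ²≤ G k
  colourable⇒χ²≤ (c , proper) = c , λ i j ij → proper _ _ (from T-≡ ij)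

+-monoˡ-≤-comm : ∀ {K′ K} j → K′ ≤ + K → K′ + + j ≤ + (j ℕ.+ K)
+-monoˡ-≤-comm {K = K} j K′≤K = ℤ.≤-trans (ℤ.+-monoˡ-≤ (+ j) K′≤K) (ℤ.≤-reflexive (cong +_ (ℕ.+-comm K j)))

punchIn-view : ∀ {n} (v w : Fin (suc n)) → w ≡ v ⊎ ∃[ i ] punchIn v i ≡ w
punchIn-view v w with w ≟ v
... | yes w≡v = inj₁ w≡v
... | no  w≢v = inj₂ (punchOut (w≢v ∘ sym) , punchIn-punchOut (w≢v ∘ sym))

module _ {n} (G : Graph (suc n)) (v : Fin (suc n)) where

  sqAdj-delete : ∀ {i j} → T (sqAdj G (punchIn v i) (punchIn v j)) →
                 T (sqAdj (delete G v) i j) ⊎ T (adj G (punchIn v i) v) × T (adj G v (punchIn v j))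
  sqAdj-delete ij with sqAdj⁻ G ij
  ... | i≢j , inj₁ adjacent = inj₁ (sqAdj⁺ (delete G v) (i≢j ∘ cong (punchIn v)) (inj₁ adjacent))
  ... | i≢j , inj₂ (k , ik , kj) with punchIn-view v k
  ... | inj₁ refl        = inj₂ (ik , kj)
  ... | inj₂ (k′ , refl) = inj₁ (sqAdj⁺ (delete G v) (i≢j ∘ cong (punchIn v)) (inj₂ (k′ , ik , kj)))

  sqAdj-closedNbhd : ∀ {u w} → T (adj G v u) → w ≡ v ⊎ T (adj G v w) → u ≢ w → T (sqAdj G u w)
  sqAdj-closedNbhd vu (inj₁ refl) u≢v = sqAdj⁺ G u≢v (inj₁ (adj-sym G vu))
  sqAdj-closedNbhd vu (inj₂ vw)   u≢w = sqAdj⁺ G u≢w (inj₂ (v , adj-sym G vu , vw))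

  LowNbr : ℤ → Fin (suc n) → Set
  LowNbr t w = T (adj G v w) × + deg² G w ≤ t

  lowNbr? : ∀ t w → Dec (LowNbr t w)
  lowNbr? t w = T? (adj G v w) ×-dec (+ deg² G w ≤? t)

  kept : ℤ → Fin (suc n) → Bool
  kept t w = ⌊ ¬? (w ≟ v) ×-dec ¬? (lowNbr? t w) ⌋

  -- The colour zero given to v is junk: v is not kept.
  keptColourable : ∀ {K t} → HighNbrsClique G v t → χ²≤ (delete G v) (suc K) → ColourableOn G (suc K) (kept t)
  keptColourable {t = t} clique (c , proper) = insertAt c v zero , keptProper
    where
    high : ∀ {w} → T (kept t w) → T (adj G v w) → + deg² G w > t
    high keptW vw = ℤ.≰⇒> (λ low → proj₂ (toWitness keptW) (vw , low))

    keptProper : ProperOn G (insertAt c v zero) (kept t)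
    keptProper {i} {j} keptI keptJ ij with punchIn-view v i | punchIn-view v j
    ... | inj₁ refl | _         = ⊥-elim (proj₁ (toWitness keptI) refl)
    ... | inj₂ _    | inj₁ refl = ⊥-elim (proj₁ (toWitness keptJ) refl)
    ... | inj₂ (i′ , refl) | inj₂ (j′ , refl)
      rewrite insertAt-punchIn c v zero i′ | insertAt-punchIn c v zero j′ with sqAdj-delete ij
    ... | inj₁ ij′       = proper i′ j′ (to T-≡ ij′)
    ... | inj₂ (iv , vj) = proper i′ j′ (clique i′ j′ (proj₁ (sqAdj⁻ G ij) ∘ cong (punchIn v))
                             (to T-≡ (adj-sym G iv)) (high keptI (adj-sym G iv)) (to T-≡ vj) (high keptJ vj))

  recolourLowNbrs : ∀ {K t} xs → Unique xs → v ∈ xs →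
                    All (λ w → w ≡ v ⊎ LowNbr t w) xs → t ≤ + (length xs ℕ.+ K) →
                    ColourableOn G (suc K) (kept t) → ColourableOn G (suc K) (avoiding xs)
  recolourLowNbrs {K} {t} xs uniq v∈xs inNbhd t≤ = extendColourableTo G kept⊆ lowBound
    where
    kept⊆ : T ∘ kept t ⊆ T ∘ avoiding xs
    kept⊆ keptW = fromWitness λ w∈xs →
      Sum.[ proj₁ (toWitness keptW) , proj₂ (toWitness keptW) ] (All.lookup inNbhd w∈xs)

    lowBound : ∀ {u} → T (avoiding xs u) → ¬ T (kept t u) → deg²In G u (avoiding xs) ℕ.≤ K
    lowBound {u} u∉xs notKept with lowNbr? t u
    ... | no ¬low = ⊥-elim (notKept (fromWitness ((λ { refl → toWitness u∉xs v∈xs }) , ¬low)))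
    ... | yes (vu , deg≤t) = deg²In-avoiding-≤ G xs uniq
          (All.tabulate λ w∈xs → sqAdj-closedNbhd vu (Sum.map₂ proj₁ (All.lookup inNbhd w∈xs))
                                                     λ { refl → toWitness u∉xs w∈xs })
          (ℤ.drop‿+≤+ (ℤ.≤-trans deg≤t t≤))

  colour-iii : ∀ {K K′} → K′ ≤ + K → + deg² G v ≤ K′ → HighNbrsClique G v (K′ + + 1) →
               χ²≤ (delete G v) (suc K) → χ²≤ G (suc K)
  colour-iii K′≤K degV clique =
      colourable⇒χ²≤ G
    ∘ extendToVertex G v [] [] [] (ℤ.drop‿+≤+ (ℤ.≤-trans degV K′≤K))
    ∘ recolourLowNbrs (v ∷ []) ([] ∷ []) (here refl) (inj₁ refl ∷ []) (+-monoˡ-≤-comm 1 K′≤K)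
    ∘ keptColourable clique

  colour-ii : ∀ {K K′ x} → K′ ≤ + K → + deg² G v ≤ K′ → T (adj G v x) → + deg² G x ≤ K′ + + 1 →
              HighNbrsClique G v (K′ + + 2) → χ²≤ (delete G v) (suc K) → χ²≤ G (suc K)
  colour-ii {K} {K′} {x} K′≤K degV vx degX clique =
      colourable⇒χ²≤ G
    ∘ extendToVertex G v [] [] [] (ℤ.drop‿+≤+ (ℤ.≤-trans degV K′≤K))
    ∘ extendToVertex G x (v ∷ []) ([] ∷ []) (sqAdj⁺ G x≢v (inj₁ xv) ∷ [])
                     (ℤ.drop‿+≤+ (ℤ.≤-trans degX (+-monoˡ-≤-comm 1 K′≤K)))
    ∘ recolourLowNbrs (x ∷ v ∷ []) ((x≢v ∷ []) ∷ [] ∷ []) (there (here refl))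
                      (inj₂ (vx , ℤ.≤-trans degX (ℤ.+-monoʳ-≤ K′ (+≤+ (s≤s z≤n)))) ∷ inj₁ refl ∷ [])
                      (+-monoˡ-≤-comm 2 K′≤K)
    ∘ keptColourable clique
    where
    xv : T (adj G x v)
    xv = adj-sym G vx
    x≢v : x ≢ v
    x≢v = adj⇒≢ G xv

lemma3p1 : (K : ℕ) (C₁ C₂ : GraphClass) →
    NonEmpty C₁ → ClosedUnderDeletion C₁ →
    (∀ n (G : Graph n) → C₂ n G → χ²≤ G (suc K)) →
    (∃[ K' ] (K' ≤ + K) ×
      (∀ n (G : Graph n) → C₁ n G → C₂ n G ⊎ Cond-ii K' G ⊎ Cond-iii K' G)) →
    ∀ n (G : Graph n) → C₁ n G → χ²≤ G (suc K)
lemma3p1 K C₁ C₂ _ closed C₂-colourable (K′ , K′≤K , cases) = colour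
  where
  colour : ∀ n (G : Graph n) → C₁ n G → χ²≤ G (suc K)
  colour zero    G _ = (λ ()) , λ ()
  colour (suc n) G G∈C₁ with cases (suc n) G G∈C₁
  ... | inj₁ G∈C₂ = C₂-colourable (suc n) G G∈C₂
  ... | inj₂ (inj₁ (v , degV , (x , vx , degX) , clique)) =
    colour-ii G v K′≤K degV (from T-≡ vx) degX clique (colour n (delete G v) (closed n G v G∈C₁))
  ... | inj₂ (inj₂ (v , degV , clique)) =
    colour-iii G v K′≤K degV clique (colour n (delete G v) (closed n G v G∈C₁))
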